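{- Let $P=\forall X\forall Y(((X\to Y)\to X)\to X)$ and $Q=P\to\forall X\,X$, and let $X$ be a type variable. If $w$ is a normal $\lambda$-term such that $\alpha:Q\to P,\ x:X,\ f:X\to X\vdash_{\mathcal{F}}w:X$, then there exists $n\in\mathbf{N}$ such that $w=(f^n\,x)$.
   Context: System $\mathcal{F}$ (Girard's second-order typed $\lambda$-calculus): types built from type variables and $\perp$ with $\to$ and $\forall X$; typing rules: variable, $\lambda$-abstraction, application, $\forall$-introduction (type variable not free in context), $\forall$-elimination. $(f^0\,x)=x$ and $(f^{n+1}\,x)=(f\,(f^n\,x))$. -}

module Defs where

open import Data.Nat using (ℕ; zero; suc; _<ᵇ_; _≡ᵇ_; pred)
open import Data.Bool using (if_then_else_)
open import Data.List using (List; []; _∷_; map)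

-- Types of System F, with de Bruijn indices for type variables.
-- tvar i is a type variable; ∀' A binds index 0 in A.

infixr 7 _⇒_

data Type : Set where
  tvar : ℕ → Type
  ⊥ᵗ   : Type
  _⇒_  : Type → Type → Type
  ∀'   : Type → Type

shift : ℕ → Type → Type
shift c (tvar i) = if i <ᵇ c then tvar i else tvar (suc i)
shift c ⊥ᵗ       = ⊥ᵗ
shift c (A ⇒ B)  = shift c A ⇒ shift c B
shift c (∀' A)   = ∀' (shift (suc c) A)

substAt : ℕ → Type → Type → Type
substAt j B (tvar i) =
  if i ≡ᵇ j then B else (if i <ᵇ j then tvar i else tvar (pred i))
substAt j B ⊥ᵗ       = ⊥ᵗ
substAt j B (A₁ ⇒ A₂) = substAt j B A₁ ⇒ substAt j B A₂
substAt j B (∀' A)   = ∀' (substAt (suc j) (shift 0 B) A)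

_[_] : Type → Type → Type
A [ B ] = substAt 0 B A

-- Pure (untyped) λ-terms with de Bruijn indices (Curry-style System F).

data Term : Set where
  var : ℕ → Term
  lam : Term → Term
  app : Term → Term → Term

data Neutral : Term → Set
data Normal  : Term → Set

data Neutral where
  var : ∀ i → Neutral (var i)
  app : ∀ {t u} → Neutral t → Normal u → Neutral (app t u)

data Normal where
  neu : ∀ {t} → Neutral t → Normal t
  lam : ∀ {t} → Normal t → Normal (lam t)

-- Typing. Contexts are lists; the head is the variable with index 0.

Ctx : Set
Ctx = List Type

data _∋_∶_ : Ctx → ℕ → Type → Set where
  here  : ∀ {Γ A} → (A ∷ Γ) ∋ zero ∶ A
  there : ∀ {Γ A B i} → Γ ∋ i ∶ A → (B ∷ Γ) ∋ suc i ∶ A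

infix 4 _⊢_∶_ _∋_∶_

data _⊢_∶_ : Ctx → Term → Type → Set where
  ax   : ∀ {Γ i A} → Γ ∋ i ∶ A → Γ ⊢ var i ∶ A
  ⇒I   : ∀ {Γ t A B} → (A ∷ Γ) ⊢ t ∶ B → Γ ⊢ lam t ∶ A ⇒ B
  ⇒E   : ∀ {Γ t u A B} → Γ ⊢ t ∶ A ⇒ B → Γ ⊢ u ∶ A → Γ ⊢ app t u ∶ B
  -- ∀-introduction: the (de Bruijn) bound variable is fresh for Γ,
  -- expressed by shifting every free type variable of Γ.
  ∀I   : ∀ {Γ t A} → map (shift 0) Γ ⊢ t ∶ A → Γ ⊢ t ∶ ∀' A
  ∀E   : ∀ {Γ t A} → Γ ⊢ t ∶ ∀' A → (B : Type) → Γ ⊢ t ∶ A [ B ]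

-- P = ∀X ∀Y (((X → Y) → X) → X)   (X = index 1, Y = index 0 inside)
P : Type
P = ∀' (∀' (((tvar 1 ⇒ tvar 0) ⇒ tvar 1) ⇒ tvar 1))

Q : Type
Q = P ⇒ ∀' (tvar 0)

-- Context α : Q → P , x : X , f : X → X   (X = tvar k),
-- so f has index 0, x index 1, α index 2.
ctx : ℕ → Ctx
ctx k = (tvar k ⇒ tvar k) ∷ tvar k ∷ (Q ⇒ P) ∷ []

fpow : ℕ → Term
fpow zero    = var 1
fpow (suc n) = app (var 0) (fpow n)

module Submission where

open import Defs
open import Data.Bool using (Bool; true; false; T; if_then_else_)
open import Data.Bool.Properties using (⇔→≡; T-≡)
open import Data.Empty using (⊥-elim)
open import Data.List using (List; []; _∷_; map)
open import Data.List.Membership.Propositional using (_∈_)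
open import Data.List.Relation.Unary.All using (all?; lookup; tabulate)
open import Data.List.Relation.Unary.Any as Any using ()
open import Data.Nat using (ℕ; zero; suc; _<ᵇ_; _≡ᵇ_; pred)
open import Data.Product using (∃; _×_; _,_; uncurry)
open import Data.Unit using (tt)
open import Function using (_∘_; mk⇔; Equivalence)
open import Relation.Nullary.Decidable using (⌊_⌋; T?; toWitness; fromWitness)
open import Relation.Binary.PropositionalEquality
  using (_≡_; _≢_; refl; sym; trans; cong; cong₂; subst; module ≡-Reasoning)

-- Interpret each type as a pair of a classical truth value and a set of shapes
-- (f, fⁿ x, abstraction, other) allowed for its normal inhabitants; there are
-- finitely many such pairs, so ∀ is a finite conjunction.  An arrow type admits
-- every abstraction, and admits a head of shape k applied to an argument of
-- shape k′ at shape k · k′ provided the argument type is true.  The guard costs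
-- nothing in the application case, since an argument type is inhabited and
-- hence true, and it is what admits α: its argument type Q is false because
-- Peirce's law P is classically valid.  Sending every type variable to
-- (true, {fⁿ x}) thus validates the context, and soundness for normal terms
-- shows that a normal inhabitant of X has shape fⁿ x.

infixr 6 _→ᵇ_

_→ᵇ_ : Bool → Bool → Bool
true  →ᵇ y = y
false →ᵇ _ = true

→ᵇ-mp : ∀ {x y} → T (x →ᵇ y) → T x → T y
→ᵇ-mp {true} x→y _ = x→y

→ᵇ-intro : ∀ {x y} → (T x → T y) → T (x →ᵇ y)
→ᵇ-intro {true}  f = f tt
→ᵇ-intro {false} _ = tt

record Searchable (A : Set) : Set where
  field
    every          : (A → Bool) → Bool
    every-sound    : ∀ p → T (every p) → ∀ a → T (p a)
    every-complete : ∀ p → (∀ a → T (p a)) → T (every p)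

  every-cong : ∀ {p q} → (∀ a → p a ≡ q a) → every p ≡ every q
  every-cong p≗q = ⇔→≡ {z = true} (mk⇔ (transfer p≗q) (transfer (sym ∘ p≗q)))
    where
    transfer : ∀ {p q} → (∀ a → p a ≡ q a) → every p ≡ true → every q ≡ true
    transfer {p} {q} p≗q every-p = Equivalence.to T-≡
      (every-complete q λ a →
        subst T (p≗q a) (every-sound p (Equivalence.from T-≡ every-p) a))

open Searchable ⦃ ... ⦄

searchable-enumerated : ∀ {A} (xs : List A) → (∀ a → a ∈ xs) → Searchable A
searchable-enumerated xs complete = record
  { every          = λ p → ⌊ all? (T? ∘ p) xs ⌋
  ; every-sound    = λ p h a → lookup (toWitness h) (complete a)
  ; every-complete = λ p h → fromWitness (tabulate λ {a} _ → h a)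
  }

searchable-× : ∀ {A B} → Searchable A → Searchable B → Searchable (A × B)
searchable-× SA SB = record
  { every          = λ p → Searchable.every SA λ a → Searchable.every SB λ b → p (a , b)
  ; every-sound    = λ p h (a , b) →
      Searchable.every-sound SB _ (Searchable.every-sound SA _ h a) b
  ; every-complete = λ p h →
      Searchable.every-complete SA _ λ a → Searchable.every-complete SB _ λ b → h (a , b)
  }

searchable-onto : ∀ {A B} (g : A → B) → (∀ b → ∃ λ a → g a ≡ b) →
  Searchable A → Searchable B
searchable-onto g onto SA = record
  { every          = λ p → Searchable.every SA (p ∘ g)
  ; every-sound    = λ p h b → sound p h (onto b)
  ; every-complete = λ p h → Searchable.every-complete SA _ (h ∘ g)
  }
  where
  sound : ∀ p → T (Searchable.every SA (p ∘ g)) → ∀ {b} → ∃ (λ a → g a ≡ b) → T (p b)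
  sound p h (a , refl) = Searchable.every-sound SA _ h a

instance
  searchable-Bool : Searchable Bool
  searchable-Bool = searchable-enumerated (true ∷ false ∷ [])
    λ { true → Any.here refl ; false → Any.there (Any.here refl) }

data Kind : Set where
  kf kfⁿx kabs kother : Kind

infixl 8 _·ₖ_

_·ₖ_ : Kind → Kind → Kind
kf ·ₖ kfⁿx = kfⁿx
_  ·ₖ _    = kother

kind : Term → Kind
kind (var 0)             = kf
kind (var 1)             = kfⁿx
kind (var (suc (suc _))) = kother
kind (lam _)             = kabs
kind (app t u)           = kind t ·ₖ kind u

·ₖ≢kabs : ∀ k k′ → k ·ₖ k′ ≢ kabs
·ₖ≢kabs kf     kfⁿx   ()
·ₖ≢kabs kf     kf     ()
·ₖ≢kabs kf     kabs   ()
·ₖ≢kabs kf     kother ()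
·ₖ≢kabs kfⁿx   _      ()
·ₖ≢kabs kabs   _      ()
·ₖ≢kabs kother _      ()

·ₖ≢kf : ∀ k k′ → k ·ₖ k′ ≢ kf
·ₖ≢kf kf     kfⁿx   ()
·ₖ≢kf kf     kf     ()
·ₖ≢kf kf     kabs   ()
·ₖ≢kf kf     kother ()
·ₖ≢kf kfⁿx   _      ()
·ₖ≢kf kabs   _      ()
·ₖ≢kf kother _      ()

·ₖ≡kfⁿx⁻¹ : ∀ k k′ → k ·ₖ k′ ≡ kfⁿx → k ≡ kf × k′ ≡ kfⁿx
·ₖ≡kfⁿx⁻¹ kf     kfⁿx   _  = refl , refl
·ₖ≡kfⁿx⁻¹ kf     kf     ()
·ₖ≡kfⁿx⁻¹ kf     kabs   ()
·ₖ≡kfⁿx⁻¹ kf     kother ()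
·ₖ≡kfⁿx⁻¹ kfⁿx   _      ()
·ₖ≡kfⁿx⁻¹ kabs   _      ()
·ₖ≡kfⁿx⁻¹ kother _      ()

kind-neutral : ∀ {t} → Neutral t → kind t ≢ kabs
kind-neutral (var 0)             ()
kind-neutral (var 1)             ()
kind-neutral (var (suc (suc _))) ()
kind-neutral (app {t} {u} _ _)   = ·ₖ≢kabs (kind t) (kind u)

kind≡kf : ∀ t → kind t ≡ kf → t ≡ var 0
kind≡kf (var 0)             _  = refl
kind≡kf (var 1)             ()
kind≡kf (var (suc (suc _))) ()
kind≡kf (lam _)             ()
kind≡kf (app t u)           eq = ⊥-elim (·ₖ≢kf (kind t) (kind u) eq)

kind≡kfⁿx : ∀ t → kind t ≡ kfⁿx → ∃ λ n → t ≡ fpow n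
kind≡kfⁿx (var 0)             ()
kind≡kfⁿx (var 1)             _  = 0 , refl
kind≡kfⁿx (var (suc (suc _))) ()
kind≡kfⁿx (lam _)             ()
kind≡kfⁿx (app t u)           eq with ·ₖ≡kfⁿx⁻¹ (kind t) (kind u) eq
... | t≡f , u≡fⁿx with kind≡kf t t≡f | kind≡kfⁿx u u≡fⁿx
...   | refl | n , refl = suc n , refl

data KindSet : Set where
  ⟨_,_,_,_⟩ : (∋kf ∋kfⁿx ∋kabs ∋kother : Bool) → KindSet

infix 7 _∈ₖ_

_∈ₖ_ : Kind → KindSet → Bool
kf     ∈ₖ ⟨ b , _ , _ , _ ⟩ = b
kfⁿx   ∈ₖ ⟨ _ , b , _ , _ ⟩ = b
kabs   ∈ₖ ⟨ _ , _ , b , _ ⟩ = b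
kother ∈ₖ ⟨ _ , _ , _ , b ⟩ = b

tabulateₖ : (Kind → Bool) → KindSet
tabulateₖ p = ⟨ p kf , p kfⁿx , p kabs , p kother ⟩

∈ₖ-tabulateₖ : ∀ p k → k ∈ₖ tabulateₖ p ≡ p k
∈ₖ-tabulateₖ p kf     = refl
∈ₖ-tabulateₖ p kfⁿx   = refl
∈ₖ-tabulateₖ p kabs   = refl
∈ₖ-tabulateₖ p kother = refl

tabulateₖ-cong : ∀ {p q} → (∀ k → p k ≡ q k) → tabulateₖ p ≡ tabulateₖ q
tabulateₖ-cong p≗q rewrite p≗q kf | p≗q kfⁿx | p≗q kabs | p≗q kother = refl

record Val : Set where
  constructor val
  field
    holds : Bool
    kinds : KindSet

open Val

instance
  searchable-Kind : Searchable Kind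
  searchable-Kind = searchable-enumerated (kf ∷ kfⁿx ∷ kabs ∷ kother ∷ [])
    λ { kf     → Any.here refl
      ; kfⁿx   → Any.there (Any.here refl)
      ; kabs   → Any.there (Any.there (Any.here refl))
      ; kother → Any.there (Any.there (Any.there (Any.here refl)))
      }

  searchable-KindSet : Searchable KindSet
  searchable-KindSet =
    searchable-onto (λ (a , b , c , d) → ⟨ a , b , c , d ⟩)
      (λ { ⟨ a , b , c , d ⟩ → (a , b , c , d) , refl })
      (searchable-× searchable-Bool
        (searchable-× searchable-Bool (searchable-× searchable-Bool searchable-Bool)))

  searchable-Val : Searchable Val
  searchable-Val =
    searchable-onto (uncurry val) (λ v → (holds v , kinds v) , refl)
      (searchable-× searchable-Bool searchable-KindSet)

Holds : Val → Set
Holds v = T (holds v)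

infix 4 _∈ᵛ_

_∈ᵛ_ : Kind → Val → Set
k ∈ᵛ v = T (k ∈ₖ kinds v)

⊥ᵛ : Val
⊥ᵛ = val false ⟨ false , false , false , false ⟩

applies : Val → Val → Kind → Bool
applies a b k = holds a →ᵇ every λ k′ → k′ ∈ₖ kinds a →ᵇ k ·ₖ k′ ∈ₖ kinds b

arrow-kinds : Val → Val → Kind → Bool
arrow-kinds a b kabs = true
arrow-kinds a b k    = applies a b k

infixr 7 _⇒ᵛ_

_⇒ᵛ_ : Val → Val → Val
a ⇒ᵛ b = val (holds a →ᵇ holds b) (tabulateₖ (arrow-kinds a b))

∀-kinds : (Val → Val) → Kind → Bool
∀-kinds F k = every λ v → k ∈ₖ kinds (F v)

∀ᵛ : (Val → Val) → Val
∀ᵛ F = val (every (holds ∘ F)) (tabulateₖ (∀-kinds F))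

applies-sound : ∀ a b k k′ → T (applies a b k) → Holds a → k′ ∈ᵛ a → k ·ₖ k′ ∈ᵛ b
applies-sound a b k k′ k↦ ha = →ᵇ-mp (every-sound _ (→ᵇ-mp k↦ ha) k′)

⇒ᵛ-apply : ∀ a b k k′ → k ≢ kabs → k ∈ᵛ a ⇒ᵛ b → Holds a → k′ ∈ᵛ a → k ·ₖ k′ ∈ᵛ b
⇒ᵛ-apply a b kabs   k′ k≢kabs = ⊥-elim (k≢kabs refl)
⇒ᵛ-apply a b kf     k′ _      = applies-sound a b kf k′
⇒ᵛ-apply a b kfⁿx   k′ _      = applies-sound a b kfⁿx k′
⇒ᵛ-apply a b kother k′ _      = applies-sound a b kother k′

∀ᵛ-kinds⁺ : ∀ F k → (∀ v → k ∈ᵛ F v) → k ∈ᵛ ∀ᵛ F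
∀ᵛ-kinds⁺ F k k∈F =
  subst T (sym (∈ₖ-tabulateₖ (∀-kinds F) k)) (every-complete (λ v → k ∈ₖ kinds (F v)) k∈F)

∀ᵛ-kinds⁻ : ∀ F k → k ∈ᵛ ∀ᵛ F → ∀ v → k ∈ᵛ F v
∀ᵛ-kinds⁻ F k k∈∀F =
  every-sound (λ v → k ∈ₖ kinds (F v)) (subst T (∈ₖ-tabulateₖ (∀-kinds F) k) k∈∀F)

-- F and G are explicit: unifying ∀ᵛ ?F with a concrete ∀ᵛ F would unfold
-- `every` into a large enumeration.
∀ᵛ-cong : ∀ F G → (∀ v → F v ≡ G v) → ∀ᵛ F ≡ ∀ᵛ G
∀ᵛ-cong F G F≗G = cong₂ val
  (every-cong {p = holds ∘ F} {q = holds ∘ G} (cong holds ∘ F≗G))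
  (tabulateₖ-cong λ k → every-cong {p = λ v → k ∈ₖ kinds (F v)} {q = λ v → k ∈ₖ kinds (G v)}
    λ v → cong (λ w → k ∈ₖ kinds w) (F≗G v))

Env : Set
Env = ℕ → Val

infixr 5 _∷ᵉ_

_∷ᵉ_ : Val → Env → Env
(v ∷ᵉ ρ) zero    = v
(v ∷ᵉ ρ) (suc i) = ρ i

⟦_⟧ : Type → Env → Val
⟦ tvar i ⟧ ρ = ρ i
⟦ ⊥ᵗ ⟧     ρ = ⊥ᵛ
⟦ A ⇒ B ⟧  ρ = ⟦ A ⟧ ρ ⇒ᵛ ⟦ B ⟧ ρ
⟦ ∀' A ⟧   ρ = ∀ᵛ λ v → ⟦ A ⟧ (v ∷ᵉ ρ)

⟦⟧-cong : ∀ A {ρ σ} → (∀ i → ρ i ≡ σ i) → ⟦ A ⟧ ρ ≡ ⟦ A ⟧ σ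
⟦⟧-cong (tvar i) ρ≗σ = ρ≗σ i
⟦⟧-cong ⊥ᵗ       ρ≗σ = refl
⟦⟧-cong (A ⇒ B)  ρ≗σ = cong₂ _⇒ᵛ_ (⟦⟧-cong A ρ≗σ) (⟦⟧-cong B ρ≗σ)
⟦⟧-cong (∀' A) {ρ} {σ} ρ≗σ =
  ∀ᵛ-cong (λ v → ⟦ A ⟧ (v ∷ᵉ ρ)) (λ v → ⟦ A ⟧ (v ∷ᵉ σ)) λ v → ⟦⟧-cong A (∷ᵉ-cong v)
  where
  ∷ᵉ-cong : ∀ v i → (v ∷ᵉ ρ) i ≡ (v ∷ᵉ σ) i
  ∷ᵉ-cong v zero    = refl
  ∷ᵉ-cong v (suc i) = ρ≗σ i

shiftᵉ : ℕ → Env → Env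
shiftᵉ c ρ i = if i <ᵇ c then ρ i else ρ (suc i)

substᵉ : ℕ → Val → Env → Env
substᵉ j w ρ i = if i ≡ᵇ j then w else (if i <ᵇ j then ρ i else ρ (pred i))

shiftᵉ-∷ᵉ : ∀ c v ρ i → shiftᵉ (suc c) (v ∷ᵉ ρ) i ≡ (v ∷ᵉ shiftᵉ c ρ) i
shiftᵉ-∷ᵉ c v ρ zero    = refl
shiftᵉ-∷ᵉ c v ρ (suc i) = refl

substᵉ-∷ᵉ : ∀ j w v ρ i → substᵉ (suc j) w (v ∷ᵉ ρ) i ≡ (v ∷ᵉ substᵉ j w ρ) i
substᵉ-∷ᵉ j       w v ρ zero          = refl
substᵉ-∷ᵉ zero    w v ρ (suc zero)    = refl
substᵉ-∷ᵉ (suc j) w v ρ (suc zero)    = refl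
substᵉ-∷ᵉ j       w v ρ (suc (suc i)) = refl

substᵉ-zero : ∀ w ρ i → substᵉ 0 w ρ i ≡ (w ∷ᵉ ρ) i
substᵉ-zero w ρ zero    = refl
substᵉ-zero w ρ (suc i) = refl

⟦shift⟧ : ∀ c A ρ → ⟦ shift c A ⟧ ρ ≡ ⟦ A ⟧ (shiftᵉ c ρ)
⟦shift⟧ c (tvar i) ρ with i <ᵇ c
... | true  = refl
... | false = refl
⟦shift⟧ c ⊥ᵗ      ρ = refl
⟦shift⟧ c (A ⇒ B) ρ = cong₂ _⇒ᵛ_ (⟦shift⟧ c A ρ) (⟦shift⟧ c B ρ)
⟦shift⟧ c (∀' A)  ρ =
  ∀ᵛ-cong (λ v → ⟦ shift (suc c) A ⟧ (v ∷ᵉ ρ)) (λ v → ⟦ A ⟧ (v ∷ᵉ shiftᵉ c ρ)) λ v →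
  trans (⟦shift⟧ (suc c) A (v ∷ᵉ ρ)) (⟦⟧-cong A (shiftᵉ-∷ᵉ c v ρ))

-- shiftᵉ 0 (v ∷ᵉ ρ) is ρ up to η, since i <ᵇ 0 reduces to false.
⟦shift₀⟧ : ∀ A v ρ → ⟦ shift 0 A ⟧ (v ∷ᵉ ρ) ≡ ⟦ A ⟧ ρ
⟦shift₀⟧ A v ρ = ⟦shift⟧ 0 A (v ∷ᵉ ρ)

⟦substAt⟧ : ∀ j B A ρ → ⟦ substAt j B A ⟧ ρ ≡ ⟦ A ⟧ (substᵉ j (⟦ B ⟧ ρ) ρ)
⟦substAt⟧ j B (tvar i) ρ with i ≡ᵇ j | i <ᵇ j
... | true  | _     = refl
... | false | true  = refl
... | false | false = refl
⟦substAt⟧ j B ⊥ᵗ        ρ = refl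
⟦substAt⟧ j B (A₁ ⇒ A₂) ρ = cong₂ _⇒ᵛ_ (⟦substAt⟧ j B A₁ ρ) (⟦substAt⟧ j B A₂ ρ)
⟦substAt⟧ j B (∀' A)    ρ =
  ∀ᵛ-cong (λ v → ⟦ substAt (suc j) (shift 0 B) A ⟧ (v ∷ᵉ ρ))
          (λ v → ⟦ A ⟧ (v ∷ᵉ substᵉ j (⟦ B ⟧ ρ) ρ)) λ v → begin
  ⟦ substAt (suc j) (shift 0 B) A ⟧ (v ∷ᵉ ρ)
    ≡⟨ ⟦substAt⟧ (suc j) (shift 0 B) A (v ∷ᵉ ρ) ⟩
  ⟦ A ⟧ (substᵉ (suc j) (⟦ shift 0 B ⟧ (v ∷ᵉ ρ)) (v ∷ᵉ ρ))
    ≡⟨ cong (λ w → ⟦ A ⟧ (substᵉ (suc j) w (v ∷ᵉ ρ))) (⟦shift₀⟧ B v ρ) ⟩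
  ⟦ A ⟧ (substᵉ (suc j) (⟦ B ⟧ ρ) (v ∷ᵉ ρ))
    ≡⟨ ⟦⟧-cong A (substᵉ-∷ᵉ j (⟦ B ⟧ ρ) v ρ) ⟩
  ⟦ A ⟧ (v ∷ᵉ substᵉ j (⟦ B ⟧ ρ) ρ)
    ∎
  where open ≡-Reasoning

⟦[]⟧ : ∀ A B ρ → ⟦ A [ B ] ⟧ ρ ≡ ⟦ A ⟧ (⟦ B ⟧ ρ ∷ᵉ ρ)
⟦[]⟧ A B ρ = trans (⟦substAt⟧ 0 B A ρ) (⟦⟧-cong A (substᵉ-zero (⟦ B ⟧ ρ) ρ))

∋-map⁻ : ∀ {f Γ i C} → map f Γ ∋ i ∶ C → ∃ λ C′ → Γ ∋ i ∶ C′ × C ≡ f C′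
∋-map⁻ {Γ = A ∷ Γ} here      = A , here , refl
∋-map⁻ {Γ = A ∷ Γ} (there x) with ∋-map⁻ x
... | C′ , y , eq = C′ , there y , eq

Satisfies : (ℕ → Val → Set) → Env → Ctx → Set
Satisfies R ρ Γ = ∀ {i C} → Γ ∋ i ∶ C → R i (⟦ C ⟧ ρ)

satisfies-shift : ∀ R ρ v {Γ} → Satisfies R ρ Γ → Satisfies R (v ∷ᵉ ρ) (map (shift 0) Γ)
satisfies-shift R ρ v sat x with ∋-map⁻ x
... | C , y , refl = subst (R _) (sym (⟦shift₀⟧ C v ρ)) (sat y)

infix 4 _⊨_ _⊩_

_⊨_ : Env → Ctx → Set
_⊨_ = Satisfies λ _ → Holds

_⊩_ : Env → Ctx → Set
_⊩_ = Satisfies λ i v → kind (var i) ∈ᵛ v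

⊨-shift : ∀ ρ v {Γ} → ρ ⊨ Γ → v ∷ᵉ ρ ⊨ map (shift 0) Γ
⊨-shift = satisfies-shift λ _ → Holds

⊩-shift : ∀ ρ v {Γ} → ρ ⊩ Γ → v ∷ᵉ ρ ⊩ map (shift 0) Γ
⊩-shift = satisfies-shift λ i v → kind (var i) ∈ᵛ v

⊨-∷ : ∀ {ρ Γ A} → Holds (⟦ A ⟧ ρ) → ρ ⊨ Γ → ρ ⊨ A ∷ Γ
⊨-∷ hA ρ⊨Γ here      = hA
⊨-∷ hA ρ⊨Γ (there x) = ρ⊨Γ x

⊢-holds : ∀ {Γ t A} → Γ ⊢ t ∶ A → ∀ ρ → ρ ⊨ Γ → Holds (⟦ A ⟧ ρ)
⊢-holds (ax x)   ρ ρ⊨Γ = ρ⊨Γ x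
⊢-holds (⇒I d)   ρ ρ⊨Γ = →ᵇ-intro λ hA → ⊢-holds d ρ (⊨-∷ hA ρ⊨Γ)
⊢-holds (⇒E d e) ρ ρ⊨Γ = →ᵇ-mp (⊢-holds d ρ ρ⊨Γ) (⊢-holds e ρ ρ⊨Γ)
⊢-holds (∀I {A = A} d) ρ ρ⊨Γ =
  every-complete (λ v → holds (⟦ A ⟧ (v ∷ᵉ ρ)))
    λ v → ⊢-holds d (v ∷ᵉ ρ) (⊨-shift ρ v ρ⊨Γ)
⊢-holds (∀E {A = A} d B) ρ ρ⊨Γ = subst Holds (sym (⟦[]⟧ A B ρ))
  (every-sound (λ v → holds (⟦ A ⟧ (v ∷ᵉ ρ))) (⊢-holds d ρ ρ⊨Γ) (⟦ B ⟧ ρ))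

⊢-kind : ∀ {Γ t A} → Γ ⊢ t ∶ A → Normal t → ∀ ρ → ρ ⊨ Γ → ρ ⊩ Γ → kind t ∈ᵛ ⟦ A ⟧ ρ
⊢-kind (ax x)  _ ρ _ ρ⊩Γ = ρ⊩Γ x
⊢-kind (⇒I _)  _ ρ _ _   = tt
⊢-kind (⇒E {t = t} {u} {A} {B} d e) (neu (app t-ne u-nf)) ρ ρ⊨Γ ρ⊩Γ =
  ⇒ᵛ-apply (⟦ A ⟧ ρ) (⟦ B ⟧ ρ) (kind t) (kind u) (kind-neutral t-ne)
    (⊢-kind d (neu t-ne) ρ ρ⊨Γ ρ⊩Γ) (⊢-holds e ρ ρ⊨Γ) (⊢-kind e u-nf ρ ρ⊨Γ ρ⊩Γ)
⊢-kind (∀I {t = t} {A} d) t-nf ρ ρ⊨Γ ρ⊩Γ =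
  ∀ᵛ-kinds⁺ (λ v → ⟦ A ⟧ (v ∷ᵉ ρ)) (kind t) λ v →
    ⊢-kind d t-nf (v ∷ᵉ ρ) (⊨-shift ρ v ρ⊨Γ) (⊩-shift ρ v ρ⊩Γ)
⊢-kind (∀E {t = t} {A} d B) t-nf ρ ρ⊨Γ ρ⊩Γ = subst (kind t ∈ᵛ_) (sym (⟦[]⟧ A B ρ))
  (∀ᵛ-kinds⁻ (λ v → ⟦ A ⟧ (v ∷ᵉ ρ)) (kind t) (⊢-kind d t-nf ρ ρ⊨Γ ρ⊩Γ) (⟦ B ⟧ ρ))

ρ₀ : Env
ρ₀ _ = val true ⟨ false , true , false , false ⟩

ρ₀⊨ctx : ∀ k → ρ₀ ⊨ ctx k
ρ₀⊨ctx k here                 = tt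
ρ₀⊨ctx k (there here)         = tt
ρ₀⊨ctx k (there (there here)) = tt

ρ₀⊩ctx : ∀ k → ρ₀ ⊩ ctx k
ρ₀⊩ctx k here                 = tt
ρ₀⊩ctx k (there here)         = tt
ρ₀⊩ctx k (there (there here)) = tt

∈ᵛ-ρ₀ : ∀ i k → k ∈ᵛ ρ₀ i → k ≡ kfⁿx
∈ᵛ-ρ₀ i kfⁿx _ = refl

mainTheorem4 : (k : ℕ) (w : Term) → Normal w → ctx k ⊢ w ∶ tvar k →
    ∃ λ (n : ℕ) → w ≡ fpow n
mainTheorem4 k w w-nf ⊢w =
  kind≡kfⁿx w (∈ᵛ-ρ₀ k (kind w) (⊢-kind ⊢w w-nf ρ₀ (ρ₀⊨ctx k) (ρ₀⊩ctx k)))
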